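{- Let $G$ be a graph, $\tau:V(G)\to\mathrm{GF}(2)^t$, $\Sigma\subseteq E(G)$ and $\alpha\in\mathrm{GF}(2)^t$. Then a set $C\subseteq E(G)$ is a cocycle of $M(G,\tau,\Sigma,\alpha)$ if and only if there exist $(\Sigma',\alpha')\in\{(\Sigma,\alpha),(\emptyset,0)\}$ and $X\subseteq V(G)$ with $\tau(X)=\alpha'$ such that $C=\delta_G(X)\triangle\Sigma'$.
   Context: For $X\subseteq V(G)$, $\tau(X)=\sum_{v\in X}\tau(v)$ and $\delta_G(X)$ is the set of edges with exactly one end in $X$; $\triangle$ is symmetric difference. Let $T=\{1,\ldots,t\}$ be a set disjoint from $E(G)$, let $A(G)$ be the $\mathrm{GF}(2)$ incidence matrix of $G$ (rows indexed by $V(G)$, columns by $E(G)$), let $B\in\mathrm{GF}(2)^{V(G)\times T}$ have row $v$ equal to $\tau(v)$, and let $\sigma\in\mathrm{GF}(2)^{E(G)}$ be the characteristic vector of $\Sigma$. The incidence matrix of $(G,\tau,\Sigma,\alpha)$ is the matrix $A$ with columns indexed by $E(G)\cup T$ whose first row is $(\sigma,\alpha)$ and whose remaining rows, indexed by $V(G)$, form $(A(G)\ B)$. $M(A)$ is the binary matroid on $E(G)\cup T$ represented by $A$, and $M(G,\tau,\Sigma,\alpha)=M(A)/T$ (contraction of $T$). A cocycle of a binary matroid is a disjoint union of cocircuits; for $M(A)$ these are exactly the supports of vectors in the row space of $A$. -}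

module Defs where

open import Data.Nat using (ℕ; zero; suc)
open import Data.Fin using (Fin; zero; suc)
open import Data.Fin.Properties using (_≟_)
open import Data.Bool using (Bool; true; false; _xor_; _∧_)
open import Data.Product using (_×_; _,_; proj₁; proj₂; Σ-syntax)
open import Data.Sum using (_⊎_; inj₁; inj₂)
open import Relation.Nullary.Decidable using (⌊_⌋)
open import Relation.Binary.PropositionalEquality using (_≡_; _≗_)

-- GF(2) is Bool with xor as addition and ∧ as multiplication.
-- Vectors in GF(2)^I are functions I → Bool; a subset of I is identified
-- with its characteristic vector I → Bool (so support of a vector = the vector).

∑ : (k : ℕ) → (Fin k → Bool) → Bool
∑ zero    f = false
∑ (suc k) f = f zero xor ∑ k (λ i → f (suc i))

-- A (finite multi)graph with vertex set Fin n and edge set Fin m;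
-- each edge has two ends (equal ends = loop).
record Graph : Set where
  field
    n    : ℕ
    m    : ℕ
    ends : Fin m → Fin n × Fin n
open Graph public

V E : Graph → Set
V G = Fin (n G)
E G = Fin (m G)

-- GF(2) incidence matrix A(G): entry (v,e) is the number of ends of e equal to v, mod 2
-- (so a loop gives a zero column).
incidence : (G : Graph) → V G → E G → Bool
incidence G v e = ⌊ v ≟ proj₁ (ends G e) ⌋ xor ⌊ v ≟ proj₂ (ends G e) ⌋

δ : (G : Graph) → (V G → Bool) → E G → Bool
δ G X e = X (proj₁ (ends G e)) xor X (proj₂ (ends G e))

τsum : (G : Graph) (t : ℕ) → (V G → Fin t → Bool) → (V G → Bool) → Fin t → Bool
τsum G t τ X i = ∑ (n G) (λ v → X v ∧ τ v i)

-- The incidence matrix of (G,τ,Σ,α): rows indexed by Fin (1 + |V(G)|)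
-- (row zero = (σ,α), row suc v = (A(G) B) row v); columns indexed by E(G) ⊎ T.
incMatrix : (G : Graph) (t : ℕ) (τ : V G → Fin t → Bool)
            (σ : E G → Bool) (α : Fin t → Bool) →
            Fin (suc (n G)) → (E G ⊎ Fin t) → Bool
incMatrix G t τ σ α zero    (inj₁ e) = σ e
incMatrix G t τ σ α zero    (inj₂ i) = α i
incMatrix G t τ σ α (suc v) (inj₁ e) = incidence G v e
incMatrix G t τ σ α (suc v) (inj₂ i) = τ v i

rowComb : {r : ℕ} {C : Set} → (Fin r → C → Bool) → (Fin r → Bool) → C → Bool
rowComb {r} A y c = ∑ r (λ j → y j ∧ A j c)

-- Cocycle of the binary matroid M(A) represented by A: support of a vector
-- in the row space of A.
IsCocycleM : {r : ℕ} {C : Set} → (Fin r → C → Bool) → (C → Bool) → Set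
IsCocycleM {r} A D = Σ[ y ∈ (Fin r → Bool) ] (D ≗ rowComb A y)

-- Cocycles of M(A)/T are exactly the cocycles of M(A) disjoint from T
-- (standard: cocircuits of M/T are the cocircuits of M avoiding T).
extendByEmpty : {Eset : Set} {t : ℕ} → (Eset → Bool) → (Eset ⊎ Fin t) → Bool
extendByEmpty C (inj₁ e) = C e
extendByEmpty C (inj₂ i) = false

IsCocycle : (G : Graph) (t : ℕ) (τ : V G → Fin t → Bool)
            (σ : E G → Bool) (α : Fin t → Bool) → (E G → Bool) → Set
IsCocycle G t τ σ α C = IsCocycleM (incMatrix G t τ σ α) (extendByEmpty {t = t} C)

{-# OPTIONS --safe #-}

-- A vector of the row space of the incidence matrix is yᵀA for y = (b, X) ∈ GF(2) × GF(2)^V(G).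
-- Since the incidence rows of X sum to δ(X), on E(G) it is δ(X) + bσ, and on T it is τ(X) + bα;
-- the latter must vanish for a cocycle of the contraction by T. The scalar b ∈ {1, 0} gives the
-- two alternatives (Σ, α) and (∅, 0).
module Submission where

open import Defs
open import Data.Nat using (ℕ; zero; suc)
open import Data.Fin using (Fin; zero; suc)
open import Data.Fin.Properties using (_≟_)
open import Data.Bool using (Bool; true; false; _xor_; _∧_)
open import Data.Bool.Properties
  using (xor-∧-commutativeRing; xor-comm; xor-same; xor-identityʳ; ∧-zeroʳ; ∧-identityʳ; ∧-distribˡ-xor)
open import Data.Product using (_×_; _,_; Σ-syntax; proj₁; proj₂)
open import Data.Sum using (_⊎_; inj₁; inj₂; [_,_])
open import Data.Vec.Functional using (_∷_)
open import Algebra.Bundles using (CommutativeRing)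
open import Function.Base using (_∘_)
open import Function.Bundles using (_⇔_; mk⇔)
open import Function.Construct.Composition using (equivalence)
open import Relation.Nullary.Decidable using (⌊_⌋; ⌊⌋-map′)
open import Relation.Binary.PropositionalEquality
  using (_≡_; _≗_; refl; sym; trans; cong; cong₂; module ≡-Reasoning)
open ≡-Reasoning

open CommutativeRing xor-∧-commutativeRing using (+-commutativeSemigroup)
open import Algebra.Properties.CommutativeSemigroup +-commutativeSemigroup using (interchange)

xor≡false⇒≡ : ∀ {x y} → x xor y ≡ false → x ≡ y
xor≡false⇒≡ {false} {false} _ = refl
xor≡false⇒≡ {true}  {true}  _ = refl

≡⇒xor≡false : ∀ {x y} → x ≡ y → x xor y ≡ false
≡⇒xor≡false {x} refl = xor-same x

∑-cong : ∀ k {f g : Fin k → Bool} → f ≗ g → ∑ k f ≡ ∑ k g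
∑-cong zero    f≗g = refl
∑-cong (suc k) f≗g = cong₂ _xor_ (f≗g zero) (∑-cong k (f≗g ∘ suc))

∑-zero : ∀ k → ∑ k (λ _ → false) ≡ false
∑-zero zero    = refl
∑-zero (suc k) = ∑-zero k

∑-distrib-xor : ∀ k (f g : Fin k → Bool) → ∑ k (λ i → f i xor g i) ≡ ∑ k f xor ∑ k g
∑-distrib-xor zero    f g = refl
∑-distrib-xor (suc k) f g = begin
  (f zero xor g zero) xor ∑ k (λ i → f (suc i) xor g (suc i))
    ≡⟨ cong ((f zero xor g zero) xor_) (∑-distrib-xor k (f ∘ suc) (g ∘ suc)) ⟩
  (f zero xor g zero) xor (∑ k (f ∘ suc) xor ∑ k (g ∘ suc))
    ≡⟨ interchange (f zero) (g zero) _ _ ⟩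
  (f zero xor ∑ k (f ∘ suc)) xor (g zero xor ∑ k (g ∘ suc)) ∎

∑-∧-indicator : ∀ k (X : Fin k → Bool) (a : Fin k) → ∑ k (λ v → X v ∧ ⌊ v ≟ a ⌋) ≡ X a
∑-∧-indicator (suc k) X zero = begin
  (X zero ∧ true) xor ∑ k (λ v → X (suc v) ∧ false)
    ≡⟨ cong₂ _xor_ (∧-identityʳ (X zero)) (∑-cong k (∧-zeroʳ ∘ X ∘ suc)) ⟩
  X zero xor ∑ k (λ _ → false)
    ≡⟨ cong (X zero xor_) (∑-zero k) ⟩
  X zero xor false
    ≡⟨ xor-identityʳ (X zero) ⟩
  X zero ∎
∑-∧-indicator (suc k) X (suc a) = begin
  (X zero ∧ false) xor ∑ k (λ v → X (suc v) ∧ ⌊ suc v ≟ suc a ⌋)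
    ≡⟨ cong₂ _xor_ (∧-zeroʳ (X zero)) (∑-cong k (λ v → cong (X (suc v) ∧_) (⌊⌋-map′ _ _ (v ≟ a)))) ⟩
  ∑ k (λ v → X (suc v) ∧ ⌊ v ≟ a ⌋)
    ≡⟨ ∑-∧-indicator k (X ∘ suc) a ⟩
  X (suc a) ∎

rowComb-incidence : (G : Graph) (X : V G → Bool) → rowComb (incidence G) X ≗ δ G X
rowComb-incidence G X e = begin
  ∑ (n G) (λ v → X v ∧ (⌊ v ≟ u ⌋ xor ⌊ v ≟ w ⌋))
    ≡⟨ ∑-cong (n G) (λ v → ∧-distribˡ-xor (X v) _ _) ⟩
  ∑ (n G) (λ v → (X v ∧ ⌊ v ≟ u ⌋) xor (X v ∧ ⌊ v ≟ w ⌋))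
    ≡⟨ ∑-distrib-xor (n G) _ _ ⟩
  ∑ (n G) (λ v → X v ∧ ⌊ v ≟ u ⌋) xor ∑ (n G) (λ v → X v ∧ ⌊ v ≟ w ⌋)
    ≡⟨ cong₂ _xor_ (∑-∧-indicator (n G) X u) (∑-∧-indicator (n G) X w) ⟩
  X u xor X w ∎
  where
  u w : V G
  u = proj₁ (ends G e)
  w = proj₂ (ends G e)

module _ (G : Graph) (t : ℕ) (τ : V G → Fin t → Bool) (σ : E G → Bool) (α : Fin t → Bool) where

  rowComb-incMatrix : (y : Fin (suc (n G)) → Bool) →
    rowComb (incMatrix G t τ σ α) y ≗
      [ (λ e → δ G (y ∘ suc) e xor (y zero ∧ σ e)) , (λ i → (y zero ∧ α i) xor τsum G t τ (y ∘ suc) i) ]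
  rowComb-incMatrix y (inj₁ e) = begin
    (y zero ∧ σ e) xor rowComb (incidence G) (y ∘ suc) e
      ≡⟨ cong ((y zero ∧ σ e) xor_) (rowComb-incidence G (y ∘ suc) e) ⟩
    (y zero ∧ σ e) xor δ G (y ∘ suc) e
      ≡⟨ xor-comm (y zero ∧ σ e) _ ⟩
    δ G (y ∘ suc) e xor (y zero ∧ σ e) ∎
  rowComb-incMatrix y (inj₂ i) = refl

  ScaledCut : (C : E G → Bool) → Set
  ScaledCut C = Σ[ b ∈ Bool ] Σ[ X ∈ (V G → Bool) ]
                  (τsum G t τ X ≗ (λ i → b ∧ α i)) × (C ≗ (λ e → δ G X e xor (b ∧ σ e)))

  isCocycle⇔scaledCut : (C : E G → Bool) → IsCocycle G t τ σ α C ⇔ ScaledCut C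
  isCocycle⇔scaledCut C = mk⇔ to from
    where
    to : IsCocycle G t τ σ α C → ScaledCut C
    to (y , C≗row) =
      y zero , y ∘ suc ,
      (λ i → sym (xor≡false⇒≡ (sym (C≗row (inj₂ i))))) ,
      (λ e → trans (C≗row (inj₁ e)) (rowComb-incMatrix y (inj₁ e)))

    from : ScaledCut C → IsCocycle G t τ σ α C
    from (b , X , τX≗bα , C≗) = b ∷ X , C≗row
      where
      C≗row : extendByEmpty C ≗ rowComb (incMatrix G t τ σ α) (b ∷ X)
      C≗row (inj₁ e) = trans (C≗ e) (sym (rowComb-incMatrix (b ∷ X) (inj₁ e)))
      C≗row (inj₂ i) = sym (≡⇒xor≡false (sym (τX≗bα i)))

  SignedCut : (C : E G → Bool) → Set
  SignedCut C =
    Σ[ σ' ∈ (E G → Bool) ] Σ[ α' ∈ (Fin t → Bool) ]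
      (((σ' ≗ σ) × (α' ≗ α)) ⊎ ((σ' ≗ (λ _ → false)) × (α' ≗ (λ _ → false))))
      × Σ[ X ∈ (V G → Bool) ]
          ((τsum G t τ X ≗ α') × (C ≗ (λ e → δ G X e xor σ' e)))

  scaledCut⇔signedCut : (C : E G → Bool) → ScaledCut C ⇔ SignedCut C
  scaledCut⇔signedCut C = mk⇔ unscale scale
    where
    unscale : ScaledCut C → SignedCut C
    unscale (true  , X , τX≗α , C≗) = σ , α , inj₁ ((λ _ → refl) , (λ _ → refl)) , X , τX≗α , C≗
    unscale (false , X , τX≗0 , C≗) = _ , _ , inj₂ ((λ _ → refl) , (λ _ → refl)) , X , τX≗0 , C≗

    scale : SignedCut C → ScaledCut C
    scale (σ' , α' , inj₁ (σ'≗σ , α'≗α) , X , τX≗α' , C≗) =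
      true , X , (λ i → trans (τX≗α' i) (α'≗α i)) , (λ e → trans (C≗ e) (cong (δ G X e xor_) (σ'≗σ e)))
    scale (σ' , α' , inj₂ (σ'≗0 , α'≗0) , X , τX≗α' , C≗) =
      false , X , (λ i → trans (τX≗α' i) (α'≗0 i)) , (λ e → trans (C≗ e) (cong (δ G X e xor_) (σ'≗0 e)))

lemma3p1 : (G : Graph) (t : ℕ) (τ : V G → Fin t → Bool)
           (σ : E G → Bool) (α : Fin t → Bool) (C : E G → Bool) →
           IsCocycle G t τ σ α C ⇔
           (Σ[ σ' ∈ (E G → Bool) ] Σ[ α' ∈ (Fin t → Bool) ]
             (((σ' ≗ σ) × (α' ≗ α)) ⊎ ((σ' ≗ (λ _ → false)) × (α' ≗ (λ _ → false))))
             × Σ[ X ∈ (V G → Bool) ]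
                 ((τsum G t τ X ≗ α') × (C ≗ (λ e → δ G X e xor σ' e))))
lemma3p1 G t τ σ α C =
  equivalence (isCocycle⇔scaledCut G t τ σ α C) (scaledCut⇔signedCut G t τ σ α C)
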